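{- Let $w\in T_L$ and let $a,b\in\mathcal{I}\setminus\{0,k(n-1)\}$ with $b-a\ge 12kL$. Let $U$ be uniformly random in $Low_a$ and $V$ uniformly random in $Low_b$, and let $\mathbf{s}(U,V)$ be the lexicographically smallest monotone connected path $(s^1,\ldots,s^m)$ from $U$ to $V$ such that $\mathcal{C}(s^i)\cap\ell(U,V)\ne\emptyset$ for all $i$. Then $$\Pr\big[w\in\mathbf{s}(U,V)\big]\le\frac{17^k}{(2L+1)^{\lfloor k/2\rfloor}}.$$
   Context: Fix positive integers $n,k,L,\rho$ with $\rho\mid k(n-1)$, $k\mid\rho$, $\rho\ge 12kL$. $wt(x)=\sum_i x_i$; $\le$ componentwise. Tube: $T_L=\{x\in\{0,\ldots,n-1\}^k:\exists i\in\{0,\ldots,n-1\},|x_c-i|\le L\ \forall c\}$. $\mathcal{I}=\{a\in\{0,\ldots,k(n-1)\}:\rho\mid a\}$, $Low_a=\{x\in T_L: wt(x)=a\}$. $\mathcal{C}(v)$ is the closed axis-aligned cube of side $1$ centered at $v$; $\ell(u,v)$ is the closed segment from $u$ to $v$. A monotone connected path is a sequence of vertices each obtained from the previous by adding a standard unit vector $e_j$. Sequences of vertices are compared lexicographically: first by the first vertex (vertices compared lexicographically as integer vectors), then by the second, and so on. -}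

module Defs where

open import Data.Nat as ℕ using (ℕ; zero; suc; _≤ᵇ_; ∣_-_∣)
open import Data.Bool using (Bool; _∧_)
open import Data.List as List using (List; []; _∷_; [_]; map; concatMap; upTo; filterᵇ)
open import Data.Bool.ListAction using (any; all)
open import Data.List.Relation.Unary.All using (All)
open import Data.Vec as Vec using (Vec; []; _∷_; toList; lookup; updateAt)
open import Data.Fin using (Fin)
open import Data.Product using (Σ; _×_; ∃)
open import Data.Sum using (_⊎_)
open import Data.Integer using (+_)
open import Data.Rational as ℚ using (ℚ; 0ℚ; 1ℚ; ½)
open import Relation.Binary.PropositionalEquality using (_≡_)
open import Data.List.Membership.Propositional using (_∈_)

Vertex : ℕ → Set
Vertex k = Vec ℕ k

allVecs : (k n : ℕ) → List (Vertex k)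
allVecs zero    n = [ [] ]
allVecs (suc k) n = concatMap (λ x → map (x ∷_) (allVecs k n)) (upTo n)

wt : ∀ {k} → Vertex k → ℕ
wt []       = 0
wt (x ∷ xs) = x ℕ.+ wt xs

inTubeᵇ : ∀ {k} → (n L : ℕ) → Vertex k → Bool
inTubeᵇ n L x = any (λ i → all (λ xc → ∣ xc - i ∣ ≤ᵇ L) (toList x)) (upTo n)

Tube : (n k L : ℕ) → List (Vertex k)
Tube n k L = filterᵇ (inTubeᵇ n L) (allVecs k n)

Low : (n k L a : ℕ) → List (Vertex k)
Low n k L a = filterᵇ (λ x → (wt x ≤ᵇ a) ∧ (a ≤ᵇ wt x)) (Tube n k L)

Step : ∀ {k} → Vertex k → Vertex k → Set
Step {k} x y = Σ (Fin k) λ j → y ≡ updateAt x j suc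

data MonPath {k : ℕ} : Vertex k → Vertex k → List (Vertex k) → Set where
  single : ∀ u → MonPath u u [ u ]
  step   : ∀ {u u′ v p} → Step u u′ → MonPath u′ v p → MonPath u v (u ∷ p)

ℕtoℚ : ℕ → ℚ
ℕtoℚ x = + x ℚ./ 1

-- 𝒞(s) ∩ ℓ(u,v) ≠ ∅ : some point u + t(v-u), 0 ≤ t ≤ 1, has |coordinate - s_c| ≤ 1/2 for all c
-- (the constraints are linear in t with rational data, so a real t exists iff a rational one does)
CubeMeetsSeg : ∀ {k} → Vertex k → Vertex k → Vertex k → Set
CubeMeetsSeg {k} s u v =
  Σ ℚ λ t → (0ℚ ℚ.≤ t) × (t ℚ.≤ 1ℚ) ×
    ((c : Fin k) →
      ℚ.∣ (ℕtoℚ (lookup u c) ℚ.+ t ℚ.* (ℕtoℚ (lookup v c) ℚ.- ℕtoℚ (lookup u c))) ℚ.- ℕtoℚ (lookup s c) ∣ ℚ.≤ ½)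

Admissible : ∀ {k} → Vertex k → Vertex k → List (Vertex k) → Set
Admissible u v p = MonPath u v p × All (λ s → CubeMeetsSeg s u v) p

data _<ᵛ_ : ∀ {k} → Vertex k → Vertex k → Set where
  here  : ∀ {k x y} {xs ys : Vertex k} → x ℕ.< y → (x ∷ xs) <ᵛ (y ∷ ys)
  there : ∀ {k x} {xs ys : Vertex k} → xs <ᵛ ys → (x ∷ xs) <ᵛ (x ∷ ys)

data _<ˢ_ {k : ℕ} : List (Vertex k) → List (Vertex k) → Set where
  halt  : ∀ {y ys} → [] <ˢ (y ∷ ys)
  here  : ∀ {x y xs ys} → x <ᵛ y → (x ∷ xs) <ˢ (y ∷ ys)
  there : ∀ {x xs ys} → xs <ˢ ys → (x ∷ xs) <ˢ (x ∷ ys)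

IsS : ∀ {k} → Vertex k → Vertex k → List (Vertex k) → Set
IsS u v s = Admissible u v s × (∀ s′ → Admissible u v s′ → (s ≡ s′) ⊎ (s <ˢ s′))

InS : ∀ {k} → Vertex k → Vertex k → Vertex k → Set
InS w u v = Σ _ λ s → IsS u v s × w ∈ s

module Submission where

-- Only one property of s(U, V) is used: the cube of each of its vertices meets ℓ(U, V).
-- If the cube of w meets ℓ(u, v) at parameter t, summing the k coordinate conditions gives
-- |a + t (b − a) − wt w| ≤ k/2.  When 2 wt w ≥ a + b this forces t ≥ 1/4, and two segments
-- from the same u pass the cube at parameters differing by at most k/(b − a); comparing one
-- coordinate at a time, their endpoints v, v′ then differ by at most 12 in every coordinate.
-- So for each u the admissible v lie in a box with 13^k ≤ 17^k points, while Low_b contains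
-- (2L + 1)^⌊k/2⌋ vertices whose coordinates pair up as j + e, j + 2L − e.  When 2 wt w ≤ a + b
-- the picture is reflected and the roles of u and v are exchanged.

module Counting where

  open import Data.Nat using (ℕ; zero; suc; _+_; _*_; _∸_; _^_; _≤_; _<_; z≤n; s≤s)
  import Data.Nat.Properties as ℕ
  open import Data.List
    using (List; []; _∷_; [_]; map; length; _++_; upTo; concatMap; cartesianProductWith; filter)
  import Data.List.Properties as List
  open import Data.List.Membership.Propositional using (_∈_; lose)
  open import Data.List.Membership.Propositional.Properties
  open import Data.List.Relation.Unary.Any using (here; there)
  import Data.List.Relation.Unary.All as All
  open import Data.List.Relation.Unary.AllPairs using (_∷_)
  open import Data.List.Relation.Unary.Unique.Propositional using (Unique)
  open import Data.List.Extrema.Nat using (argmin; f[argmin]≤f[⊤]; f[argmin]≤f[xs]; argmin-all)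
  open import Data.Vec using ([]; _∷_; lookup; tabulate; replicate)
  open import Data.Vec.Properties using (lookup∘tabulate)
  open import Data.Fin using (Fin; zero; suc)
  open import Data.Product using (_×_; _,_; proj₁; proj₂)
  open import Data.Sum using (inj₁; inj₂)
  open import Data.Empty using (⊥-elim)
  open import Relation.Binary.Definitions using (DecidableEquality)
  open import Relation.Binary.PropositionalEquality using (_≡_; refl; sym; trans; cong; cong₂; subst)
  open import Defs using (Vertex)

  Unique-⊆⇒length≤ : ∀ {A : Set} {xs ys : List A} →
    Unique xs → (∀ {x} → x ∈ xs → x ∈ ys) → length xs ≤ length ys
  Unique-⊆⇒length≤ {xs = []} _ _ = z≤n
  Unique-⊆⇒length≤ {xs = x ∷ xs} {ys} (x∉xs ∷ unique) xs⊆ys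
    with ys₁ , ys₂ , refl ← ∈-∃++ (xs⊆ys (here refl)) =
    subst (suc (length xs) ≤_) (sym (List.length-++-sucʳ ys₁ x ys₂))
      (s≤s (Unique-⊆⇒length≤ unique xs⊆ys₁++ys₂))
    where
    xs⊆ys₁++ys₂ : ∀ {y} → y ∈ xs → y ∈ ys₁ ++ ys₂
    xs⊆ys₁++ys₂ {y} y∈xs with ∈-++⁻ ys₁ (xs⊆ys (there y∈xs))
    ... | inj₁ y∈ys₁ = ∈-++⁺ˡ y∈ys₁
    ... | inj₂ (here refl) = ⊥-elim (All.lookup x∉xs y∈xs refl)
    ... | inj₂ (there y∈ys₂) = ∈-++⁺ʳ ys₁ y∈ys₂

  length-cartesianProductWith : ∀ {A B C : Set} (f : A → B → C) xs ys →
    length (cartesianProductWith f xs ys) ≡ length xs * length ys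
  length-cartesianProductWith f [] ys = refl
  length-cartesianProductWith f (x ∷ xs) ys = trans (List.length-++ (map (f x) ys))
    (cong₂ _+_ (List.length-map (f x) ys) (length-cartesianProductWith f xs ys))

  length-concatMap-const : ∀ {A B : Set} (f : A → List B) {m} → (∀ x → length (f x) ≡ m) →
    ∀ xs → length (concatMap f xs) ≡ length xs * m
  length-concatMap-const f |f|≡m [] = refl
  length-concatMap-const f |f|≡m (x ∷ xs) = trans (List.length-++ (f x))
    (cong₂ _+_ (|f|≡m x) (length-concatMap-const f |f|≡m xs))

  box : ∀ {k} → ℕ → Vertex k → List (Vertex k)
  box s [] = [ [] ]
  box s (m ∷ ms) = cartesianProductWith _∷_ (map (m +_) (upTo s)) (box s ms)

  length-box : ∀ {k} s (m : Vertex k) → length (box s m) ≡ s ^ k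
  length-box s [] = refl
  length-box s (m ∷ ms) = trans (length-cartesianProductWith _∷_ (map (m +_) (upTo s)) (box s ms))
    (cong₂ _*_ (trans (List.length-map (m +_) (upTo s)) (List.length-upTo s)) (length-box s ms))

  ∈-box⁺ : ∀ {k} s (m x : Vertex k) →
    (∀ c → lookup m c ≤ lookup x c) → (∀ c → lookup x c < lookup m c + s) → x ∈ box s m
  ∈-box⁺ s [] [] _ _ = here refl
  ∈-box⁺ s (m ∷ ms) (x ∷ xs) m≤x x<m+s =
    ∈-cartesianProductWith⁺ _∷_ x∈window (∈-box⁺ s ms xs (λ c → m≤x (suc c)) (λ c → x<m+s (suc c)))
    where
    m+[x∸m]≡x : m + (x ∸ m) ≡ x
    m+[x∸m]≡x = ℕ.m+[n∸m]≡n (m≤x zero)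
    x∈window : x ∈ map (m +_) (upTo s)
    x∈window = subst (_∈ map (m +_) (upTo s)) m+[x∸m]≡x
      (∈-map⁺ (m +_) (∈-upTo⁺ (ℕ.+-cancelˡ-< m _ _ (subst (_< m + s) (sym m+[x∸m]≡x) (x<m+s zero)))))

  lowerCorner : ∀ {k} → List (Vertex k) → Vertex k
  lowerCorner [] = replicate _ 0
  lowerCorner (y ∷ ys) = tabulate λ c → lookup (argmin (λ z → lookup z c) y ys) c

  -- each coordinate attains its minimum over vs, so a one-sided spread d confines vs to a box of side d + 1
  spread⇒⊆box : ∀ {k} d (vs : List (Vertex k)) →
    (∀ {v v′} → v ∈ vs → v′ ∈ vs → ∀ c → lookup v c ≤ lookup v′ c + d) →
    ∀ {v} → v ∈ vs → v ∈ box (suc d) (lowerCorner vs)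
  spread⇒⊆box d (y ∷ ys) spread {v} v∈vs = ∈-box⁺ (suc d) (lowerCorner (y ∷ ys)) v corner≤v v<corner+d+1
    where
    f : Fin _ → Vertex _ → ℕ
    f c z = lookup z c
    minimiser : ∀ c → Vertex _
    minimiser c = argmin (f c) y ys
    corner≡ : ∀ c → lookup (lowerCorner (y ∷ ys)) c ≡ f c (minimiser c)
    corner≡ c = lookup∘tabulate (λ c → f c (minimiser c)) c
    minimiser∈ : ∀ c → minimiser c ∈ y ∷ ys
    minimiser∈ c = argmin-all (f c) (here refl) (All.tabulate there)
    minimal : ∀ c {z} → z ∈ y ∷ ys → f c (minimiser c) ≤ f c z
    minimal c (here refl) = f[argmin]≤f[⊤] {f = f c} y ys
    minimal c (there z∈ys) = All.lookup (f[argmin]≤f[xs] {f = f c} y ys) z∈ys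
    corner≤v : ∀ c → lookup (lowerCorner (y ∷ ys)) c ≤ lookup v c
    corner≤v c = subst (_≤ lookup v c) (sym (corner≡ c)) (minimal c v∈vs)
    v<corner+d+1 : ∀ c → lookup v c < lookup (lowerCorner (y ∷ ys)) c + suc d
    v<corner+d+1 c = subst (λ m → lookup v c < m + suc d) (sym (corner≡ c))
      (subst (suc (lookup v c) ≤_) (sym (ℕ.+-suc _ d)) (s≤s (spread v∈vs (minimiser∈ c) c)))

  module _ {A : Set} {k : ℕ} (_≟_ : DecidableEquality A) where

    fibre : List (A × Vertex k) → A → List (Vertex k)
    fibre P u = map proj₂ (filter (λ p → proj₁ p ≟ u) P)

    ∈-fibre⁺ : ∀ {P u v} → (u , v) ∈ P → v ∈ fibre P u
    ∈-fibre⁺ {u = u} uv∈P = ∈-map⁺ proj₂ (∈-filter⁺ (λ p → proj₁ p ≟ u) uv∈P refl)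

    ∈-fibre⁻ : ∀ {P u v} → v ∈ fibre P u → (u , v) ∈ P
    ∈-fibre⁻ {P} {u} v∈fibre with ∈-map⁻ proj₂ v∈fibre
    ... | _ , p∈filter , refl with ∈-filter⁻ (λ p → proj₁ p ≟ u) {xs = P} p∈filter
    ...   | p∈P , refl = p∈P

    Unique-pairs-length≤ : ∀ d (P : List (A × Vertex k)) (keys : List A) → Unique P →
      (∀ {u v} → (u , v) ∈ P → u ∈ keys) →
      (∀ {u v v′} → (u , v) ∈ P → (u , v′) ∈ P → ∀ c → lookup v c ≤ lookup v′ c + d) →
      length P ≤ length keys * suc d ^ k
    Unique-pairs-length≤ d P keys unique key∈keys spread = begin
      length P                   ≤⟨ Unique-⊆⇒length≤ unique P⊆cover ⟩
      length (concatMap cell keys) ≡⟨ length-concatMap-const cell length-cell keys ⟩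
      length keys * suc d ^ k    ∎
      where
      open ℕ.≤-Reasoning
      cell : A → List (A × Vertex k)
      cell u = map (u ,_) (box (suc d) (lowerCorner (fibre P u)))
      length-cell : ∀ u → length (cell u) ≡ suc d ^ k
      length-cell u = trans (List.length-map (u ,_) (box (suc d) corner)) (length-box (suc d) corner)
        where corner = lowerCorner (fibre P u)
      P⊆cover : ∀ {p} → p ∈ P → p ∈ concatMap cell keys
      P⊆cover {u , v} uv∈P = ∈-concatMap⁺ cell (lose (key∈keys uv∈P) (∈-map⁺ (u ,_)
        (spread⇒⊆box d (fibre P u) (λ v∈ v′∈ → spread (∈-fibre⁻ v∈) (∈-fibre⁻ v′∈)) (∈-fibre⁺ uv∈P))))

module Layers where

  open import Data.Nat using (ℕ; zero; suc; _+_; _*_; _∸_; _^_; _/_; _≤_; _<_; z≤n; s≤s; ∣_-_∣; _≤ᵇ_)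
  import Data.Nat.Properties as ℕ
  open import Data.Nat.DivMod using (m/n≡1+[m∸n]/n)
  open import Data.Nat.Solver using (module +-*-Solver)
  open import Data.Bool using (T; _∧_)
  import Data.Bool.Properties as Bool
  open import Data.Bool.ListAction using (any; all)
  open import Data.List using (List; [_]; map; length; upTo; cartesianProductWith)
  import Data.List.Properties as List
  open import Data.List.Membership.Propositional using (_∈_; lose)
  open import Data.List.Membership.Propositional.Properties
  open import Data.List.Relation.Unary.Any using (here; satisfied)
  open import Data.List.Relation.Unary.Any.Properties using (any⁺; any⁻)
  open import Data.List.Relation.Unary.All.Properties using (all⁺; all⁻)
  open import Data.List.Relation.Unary.Unique.Propositional using (Unique)
  import Data.List.Relation.Unary.Unique.Propositional.Properties as Unique
  open import Data.Vec using ([]; _∷_; lookup; toList)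
  import Data.Vec.Properties as Vec
  import Data.Vec.Relation.Unary.All.Properties as VecAll
  open import Data.Fin using (zero; suc)
  open import Data.Product using (∃; _×_; _,_; proj₁; proj₂)
  open import Function.Bundles using (Equivalence)
  open import Relation.Nullary.Decidable using (T?)
  open import Relation.Binary.PropositionalEquality using (_≡_; refl; sym; trans; cong; cong₂; subst; module ≡-Reasoning)
  open import Data.List.Relation.Unary.All using ([])
  open import Data.List.Relation.Unary.AllPairs using ([]; _∷_)
  open import Defs
  open Counting using (Unique-⊆⇒length≤; length-cartesianProductWith)

  Within : ∀ {k} → ℕ → ℕ → Vertex k → Set
  Within L i x = ∀ c → ∣ lookup x c - i ∣ ≤ L

  ≤+⇒∣-∣≤ : ∀ m n o → m ≤ n + o → n ≤ m + o → ∣ m - n ∣ ≤ o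
  ≤+⇒∣-∣≤ zero n o _ n≤o = n≤o
  ≤+⇒∣-∣≤ (suc m) zero o m<o _ = m<o
  ≤+⇒∣-∣≤ (suc m) (suc n) o (s≤s m≤n+o) (s≤s n≤m+o) = ≤+⇒∣-∣≤ m n o m≤n+o n≤m+o

  ∣-∣≤⇒≤+ : ∀ {m n o} → ∣ m - n ∣ ≤ o → m ≤ n + o × n ≤ m + o
  ∣-∣≤⇒≤+ {m} {n} h = ℕ.≤-trans (ℕ.m≤n+∣m-n∣ m n) (ℕ.+-monoʳ-≤ n h)
                    , ℕ.≤-trans (ℕ.m≤n+∣n-m∣ n m) (ℕ.+-monoʳ-≤ m h)

  Within⇒wt≤ : ∀ {k L i} (x : Vertex k) → Within L i x → wt x ≤ k * (i + L)
  Within⇒wt≤ [] _ = z≤n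
  Within⇒wt≤ (x ∷ xs) near = ℕ.+-mono-≤ (proj₁ (∣-∣≤⇒≤+ (near zero))) (Within⇒wt≤ xs (λ c → near (suc c)))

  Within⇒wt≥ : ∀ {k L i} (x : Vertex k) → Within L i x → k * i ≤ wt x + k * L
  Within⇒wt≥ [] _ = z≤n
  Within⇒wt≥ {suc k} {L} (x ∷ xs) near = ℕ.≤-trans
    (ℕ.+-mono-≤ (proj₂ (∣-∣≤⇒≤+ {x} (near zero))) (Within⇒wt≥ xs (λ c → near (suc c))))
    (ℕ.≤-reflexive (solve 4 (λ x L w kL → (x :+ L) :+ (w :+ kL) := (x :+ w) :+ (L :+ kL)) refl x L (wt xs) (k * L)))
    where open +-*-Solver

  ∈Low⁻ : ∀ {n k L a} {x : Vertex k} → x ∈ Low n k L a → wt x ≡ a × ∃ λ i → Within L i x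
  ∈Low⁻ {n} {k} {L} {a} {x} x∈Low
    with x∈Tube , weight ← ∈-filter⁻ (λ y → T? ((wt y ≤ᵇ a) ∧ (a ≤ᵇ wt y))) {xs = Tube n k L} x∈Low
    with _ , tube ← ∈-filter⁻ (λ y → T? (inTubeᵇ n L y)) {xs = allVecs k n} x∈Tube
    with i , near ← satisfied (any⁻ _ (upTo n) tube)
    with wt≤a , a≤wt ← Equivalence.to (Bool.T-∧ {wt x ≤ᵇ a}) weight
    = ℕ.≤-antisym (ℕ.≤ᵇ⇒≤ _ _ wt≤a) (ℕ.≤ᵇ⇒≤ _ _ a≤wt)
    , i , λ c → ℕ.≤ᵇ⇒≤ _ _ (VecAll.lookup⁺ (VecAll.toList⁻ (all⁺ (λ xc → ∣ xc - i ∣ ≤ᵇ L) (toList x) near)) c)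

  ∈-allVecs⁺ : ∀ {k} n (x : Vertex k) → (∀ c → lookup x c < n) → x ∈ allVecs k n
  ∈-allVecs⁺ n [] _ = here refl
  ∈-allVecs⁺ {suc k} n (x ∷ xs) x<n = ∈-concatMap⁺ (λ y → map (y ∷_) (allVecs k n))
    (lose (∈-upTo⁺ (x<n zero)) (∈-map⁺ (x ∷_) (∈-allVecs⁺ n xs (λ c → x<n (suc c)))))

  ∈Low⁺ : ∀ {n k L a} i {x : Vertex k} → i + L < n → Within L i x → wt x ≡ a → x ∈ Low n k L a
  ∈Low⁺ {n} {k} {L} {a} i {x} i+L<n near refl =
    ∈-filter⁺ (λ y → T? ((wt y ≤ᵇ a) ∧ (a ≤ᵇ wt y))) {xs = Tube n k L}
      (∈-filter⁺ (λ y → T? (inTubeᵇ n L y)) {xs = allVecs k n} (∈-allVecs⁺ n x x<n) x∈Tube)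
      (Equivalence.from (Bool.T-∧ {wt x ≤ᵇ wt x}) (ℕ.≤⇒≤ᵇ (ℕ.≤-refl {wt x}) , ℕ.≤⇒≤ᵇ (ℕ.≤-refl {wt x})))
    where
    x<n : ∀ c → lookup x c < n
    x<n c = ℕ.≤-<-trans (proj₁ (∣-∣≤⇒≤+ (near c))) i+L<n
    x∈Tube : T (inTubeᵇ n L x)
    x∈Tube = any⁺ _ (lose (∈-upTo⁺ (ℕ.≤-<-trans (ℕ.m≤m+n i L) i+L<n))
      (all⁻ (λ xc → ∣ xc - i ∣ ≤ᵇ L) (VecAll.toList⁺ (VecAll.lookup⁻ {xs = x} (λ c → ℕ.≤⇒≤ᵇ (near c))))))

  pairUp : ∀ {k} (L j e : ℕ) → Vertex k → Vertex (suc (suc k))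
  pairUp L j e x = j + e ∷ j + (2 * L ∸ e) ∷ x

  -- each pair of coordinates sums to 2 (j + L); in odd dimension one coordinate stays at j + L
  balanced : (L j k : ℕ) → List (Vertex k)
  balanced L j zero = [ [] ]
  balanced L j (suc zero) = [ j + L ∷ [] ]
  balanced L j (suc (suc k)) = cartesianProductWith (pairUp L j) (upTo (2 * L + 1)) (balanced L j k)

  length-balanced : ∀ L j k → length (balanced L j k) ≡ (2 * L + 1) ^ (k / 2)
  length-balanced L j zero = refl
  length-balanced L j (suc zero) = refl
  length-balanced L j (suc (suc k)) = begin
    length (balanced L j (suc (suc k)))
      ≡⟨ length-cartesianProductWith (pairUp L j) (upTo (2 * L + 1)) (balanced L j k) ⟩
    length (upTo (2 * L + 1)) * length (balanced L j k)
      ≡⟨ cong₂ _*_ (List.length-upTo (2 * L + 1)) (length-balanced L j k) ⟩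
    (2 * L + 1) * (2 * L + 1) ^ (k / 2)
      ≡⟨ cong ((2 * L + 1) ^_) (sym (m/n≡1+[m∸n]/n {suc (suc k)} {2} (s≤s (s≤s z≤n)))) ⟩
    (2 * L + 1) ^ (suc (suc k) / 2) ∎
    where open ≡-Reasoning

  Unique-balanced : ∀ L j k → Unique (balanced L j k)
  Unique-balanced L j zero = [] ∷ []
  Unique-balanced L j (suc zero) = [] ∷ []
  Unique-balanced L j (suc (suc k)) =
    Unique.cartesianProductWith⁺ (pairUp L j) pairUp-injective (Unique.upTo⁺ (2 * L + 1)) (Unique-balanced L j k)
    where
    pairUp-injective : ∀ {e e′ : ℕ} {x x′ : Vertex k} → pairUp L j e x ≡ pairUp L j e′ x′ → e ≡ e′ × x ≡ x′
    pairUp-injective eq with j+e≡j+e′ , eq′ ← Vec.∷-injective eq =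
      ℕ.+-cancelˡ-≡ j _ _ j+e≡j+e′ , proj₂ (Vec.∷-injective eq′)

  ∈balanced⇒ : ∀ L j k {x} → x ∈ balanced L j k → wt x ≡ k * (j + L) × Within L (j + L) x
  ∈balanced⇒ L j zero (here refl) = refl , λ ()
  ∈balanced⇒ L j (suc zero) (here refl) = refl , λ { zero → subst (_≤ L) (sym (ℕ.m≡n⇒∣m-n∣≡0 {j + L} refl)) z≤n }
  ∈balanced⇒ L j (suc (suc k)) x∈
    with e , x , e<2L+1 , x∈balanced , refl ← ∈-cartesianProductWith⁻ (pairUp L j) (upTo (2 * L + 1)) (balanced L j k) x∈
    with wt-x , near-x ← ∈balanced⇒ L j k x∈balanced = weight , near
    where
    open +-*-Solver
    e≤2L : e ≤ 2 * L
    e≤2L = ℕ.≤-pred (subst (suc e ≤_) (ℕ.+-comm (2 * L) 1) (∈-upTo⁻ e<2L+1))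
    e+d≡L+L : e + (2 * L ∸ e) ≡ L + L
    e+d≡L+L = trans (ℕ.m+[n∸m]≡n e≤2L) (cong (L +_) (ℕ.+-identityʳ L))
    weight : (j + e) + ((j + (2 * L ∸ e)) + wt x) ≡ suc (suc k) * (j + L)
    weight = begin
      (j + e) + ((j + (2 * L ∸ e)) + wt x)
        ≡⟨ solve 4 (λ j e d w → (j :+ e) :+ ((j :+ d) :+ w) := (j :+ j) :+ (e :+ d) :+ w) refl j e (2 * L ∸ e) (wt x) ⟩
      (j + j) + (e + (2 * L ∸ e)) + wt x
        ≡⟨ cong₂ (λ s w → (j + j) + s + w) e+d≡L+L wt-x ⟩
      (j + j) + (L + L) + k * (j + L)
        ≡⟨ solve 3 (λ j L k → (j :+ j) :+ (L :+ L) :+ k :* (j :+ L) := (con 2 :+ k) :* (j :+ L)) refl j L k ⟩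
      suc (suc k) * (j + L) ∎
      where open ≡-Reasoning
    near-centre : ∀ f → f ≤ 2 * L → ∣ j + f - j + L ∣ ≤ L
    near-centre f f≤2L = subst (_≤ L) (sym (ℕ.∣m+n-m+o∣≡∣n-o∣ j f L))
      (≤+⇒∣-∣≤ f L L (subst (f ≤_) (cong (L +_) (ℕ.+-identityʳ L)) f≤2L) (ℕ.m≤n+m L f))
    near : Within L (j + L) (pairUp L j e x)
    near zero = near-centre e e≤2L
    near (suc zero) = near-centre (2 * L ∸ e) (ℕ.m∸n≤m (2 * L) e)
    near (suc (suc c)) = near-x c

  Low-length≥ : ∀ n k L j → j + L + L < n → (2 * L + 1) ^ (k / 2) ≤ length (Low n k L (k * (j + L)))
  Low-length≥ n k L j j+2L<n = subst (_≤ length (Low n k L (k * (j + L)))) (length-balanced L j k)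
    (Unique-⊆⇒length≤ (Unique-balanced L j k) λ x∈ →
      let weight , near = ∈balanced⇒ L j k x∈ in ∈Low⁺ (j + L) j+2L<n near weight)

module SegmentArithmetic where

  open import Data.Nat as ℕ using (ℕ; zero; suc)
  import Data.Nat.Properties as ℕ
  open import Data.Integer as ℤ using (+_)
  import Data.Integer.Properties as ℤ
  open import Data.Nat.Coprimality using (1-coprimeTo; sym)
  open import Data.Rational
    using (ℚ; 0ℚ; 1ℚ; ½; mkℚ; _/_; _+_; _*_; _-_; -_; _≤_; _<_; ∣_∣; *≤*; positive; nonNegative)
  import Data.Rational.Properties as ℚ
  open import Data.Rational.Solver using (module +-*-Solver)
  open import Data.Fin using (Fin; zero; suc)
  open import Defs using (Vertex; wt; ℕtoℚ; Low; CubeMeetsSeg)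
  open import Data.List.Membership.Propositional using (_∈_)
  open import Data.Vec using ([]; _∷_; lookup)
  open Layers using (∈Low⁻; ∣-∣≤⇒≤+; Within⇒wt≤; Within⇒wt≥)
  open import Data.Sum using (_⊎_; inj₁; inj₂)
  open import Data.Product using (∃; _×_; _,_; proj₁; proj₂)
  open import Relation.Binary.PropositionalEquality
    using (_≡_; refl; cong; cong₂; cong-app; subst; subst₂; trans)
    renaming (sym to ≡-sym)
  open +-*-Solver

  infix 4 0≤_
  0≤_ : ℚ → Set
  0≤ p = 0ℚ ≤ p

  0≤-≡ : ∀ {p q} → 0≤ p → p ≡ q → 0≤ q
  0≤-≡ h refl = h

  0≤-+ : ∀ {p q} → 0≤ p → 0≤ q → 0≤ p + q
  0≤-+ = ℚ.+-mono-≤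

  0≤-* : ∀ {p q} → 0≤ p → 0≤ q → 0≤ p * q
  0≤-* {p} {q} 0≤p 0≤q = ℚ.nonNegative⁻¹ (p * q)
    {{ℚ.nonNeg*nonNeg⇒nonNeg p {{nonNegative 0≤p}} q {{nonNegative 0≤q}}}}

  ≤⇒0≤- : ∀ {p q} → p ≤ q → 0≤ q - p
  ≤⇒0≤- {p} {q} p≤q = subst (_≤ q - p) (ℚ.+-inverseʳ p) (ℚ.+-monoˡ-≤ (- p) p≤q)

  0≤-⇒≤ : ∀ {p q} → 0≤ q - p → p ≤ q
  0≤-⇒≤ {p} {q} h = subst₂ _≤_ (ℚ.+-identityˡ p) (solve 2 (λ q p → (q :- p) :+ p := q) refl q p)
    (ℚ.+-monoˡ-≤ p h)

  0≤-cancelʳ : ∀ {p q} → 0ℚ < q → 0≤ p * q → 0≤ p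
  0≤-cancelʳ {p} {q} 0<q h = ℚ.*-cancelʳ-≤-pos q {{positive 0<q}} (subst (_≤ p * q) (≡-sym (ℚ.*-zeroˡ q)) h)

  0<-* : ∀ {p q} → 0ℚ < p → 0ℚ < q → 0ℚ < p * q
  0<-* {p} {q} 0<p 0<q = ℚ.positive⁻¹ (p * q) {{ℚ.pos*pos⇒pos p {{positive 0<p}} q {{positive 0<q}}}}

  0≤∨0≤- : ∀ p → 0≤ p ⊎ 0≤ - p
  0≤∨0≤- p with ℚ.≤-total 0ℚ p
  ... | inj₁ 0≤p = inj₁ 0≤p
  ... | inj₂ p≤0 = inj₂ (subst 0≤_ (ℚ.+-identityˡ (- p)) (≤⇒0≤- p≤0))

  ∣∣≤⇒0≤± : ∀ {p r} → ∣ p ∣ ≤ r → 0≤ r - p × 0≤ r + p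
  ∣∣≤⇒0≤± {p} {r} ∣p∣≤r with ℚ.∣p∣≡p∨∣p∣≡-p p
  ... | inj₁ ∣p∣≡p = r-p , 0≤-≡ (0≤-+ (0≤-+ r-p 0≤p) 0≤p) (solve 2 (λ r p → ((r :- p) :+ p) :+ p := r :+ p) refl r p)
    where
    r-p = ≤⇒0≤- (subst (_≤ r) ∣p∣≡p ∣p∣≤r)
    0≤p = 0≤-≡ (ℚ.0≤∣p∣ p) ∣p∣≡p
  ... | inj₂ ∣p∣≡-p = 0≤-≡ (0≤-+ (0≤-+ r+p 0≤-p) 0≤-p) (solve 2 (λ r p → ((r :- (:- p)) :+ (:- p)) :+ (:- p) := r :- p) refl r p)
                    , 0≤-≡ r+p (solve 2 (λ r p → r :- (:- p) := r :+ p) refl r p)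
    where
    r+p = ≤⇒0≤- (subst (_≤ r) ∣p∣≡-p ∣p∣≤r)
    0≤-p = 0≤-≡ (ℚ.0≤∣p∣ p) ∣p∣≡-p

  -- opaque, so that unification never unfolds the gcd normalisation inside ℕtoℚ
  opaque
    ι : ℕ → ℚ
    ι = ℕtoℚ

    ι≡ℕtoℚ : ι ≡ ℕtoℚ
    ι≡ℕtoℚ = refl

    ι≡mkℚ : ∀ m → ι m ≡ mkℚ (+ m) 0 (sym (1-coprimeTo m))
    ι≡mkℚ m = ℚ.normalize-coprime (sym (1-coprimeTo m))

    ι-+ : ∀ m n → ι (m ℕ.+ n) ≡ ι m + ι n
    ι-+ m n rewrite ι≡mkℚ m | ι≡mkℚ n = ℚ./-cong {+ (m ℕ.+ n)} {1}
      (trans (ℤ.pos-+ m n) (cong₂ ℤ._+_ (≡-sym (ℤ.*-identityʳ (+ m))) (≡-sym (ℤ.*-identityʳ (+ n))))) refl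

    ι-* : ∀ m n → ι (m ℕ.* n) ≡ ι m * ι n
    ι-* m n rewrite ι≡mkℚ m | ι≡mkℚ n = ℚ./-cong {+ (m ℕ.* n)} {1} (ℤ.pos-* m n) refl

    ι-mono-≤ : ∀ {m n} → m ℕ.≤ n → ι m ≤ ι n
    ι-mono-≤ {m} {n} m≤n rewrite ι≡mkℚ m | ι≡mkℚ n =
      *≤* (subst₂ ℤ._≤_ (≡-sym (ℤ.*-identityʳ (+ m))) (≡-sym (ℤ.*-identityʳ (+ n))) (ℤ.+≤+ m≤n))

    ι-cancel-≤ : ∀ {m n} → ι m ≤ ι n → m ℕ.≤ n
    ι-cancel-≤ {m} {n} h rewrite ι≡mkℚ m | ι≡mkℚ n =
      ℤ.drop‿+≤+ (subst₂ ℤ._≤_ (ℤ.*-identityʳ (+ m)) (ℤ.*-identityʳ (+ n)) (ℚ.drop-*≤* h))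

    ι-0 : ι 0 ≡ 0ℚ
    ι-0 = refl

    ι-1 : ι 1 ≡ 1ℚ
    ι-1 = refl

  0≤ι : ∀ m → 0≤ ι m
  0≤ι m = subst (_≤ ι m) ι-0 (ι-mono-≤ ℕ.z≤n)

  -- the quantity bounded by ½ in CubeMeetsSeg: point t of the segment from x to y, minus z
  offset : ℚ → ℚ → ℚ → ℚ → ℚ
  offset t x y z = x + t * (y - x) - z

  weight-offset≤ : ∀ {k} (t : ℚ) (u v w : Vertex k) →
    (∀ c → ∣ offset t (ι (lookup u c)) (ι (lookup v c)) (ι (lookup w c)) ∣ ≤ ½) →
    ∣ offset t (ι (wt u)) (ι (wt v)) (ι (wt w)) ∣ ≤ ½ * ι k
  weight-offset≤ t [] [] [] _ rewrite ι-0 = subst (λ q → ∣ q ∣ ≤ ½ * 0ℚ)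
    (solve 1 (λ t → con 0ℚ := con 0ℚ :+ t :* (con 0ℚ :- con 0ℚ) :- con 0ℚ) refl t) (ℚ.≤-reflexive refl)
  weight-offset≤ {suc k} t (x ∷ u) (y ∷ v) (z ∷ w) h = begin
    ∣ offset t (ι (x ℕ.+ wt u)) (ι (y ℕ.+ wt v)) (ι (z ℕ.+ wt w)) ∣
      ≡⟨ cong ∣_∣ (offset-additive (ι-+ x (wt u)) (ι-+ y (wt v)) (ι-+ z (wt w))) ⟩
    ∣ offset t X Y Z + offset t X′ Y′ Z′ ∣
      ≤⟨ ℚ.∣p+q∣≤∣p∣+∣q∣ (offset t X Y Z) (offset t X′ Y′ Z′) ⟩
    ∣ offset t X Y Z ∣ + ∣ offset t X′ Y′ Z′ ∣
      ≤⟨ ℚ.+-mono-≤ (h zero) (weight-offset≤ t u v w (λ c → h (suc c))) ⟩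
    ½ + ½ * ι k
      ≡⟨ solve 1 (λ K → con ½ :+ con ½ :* K := con ½ :* (con 1ℚ :+ K)) refl (ι k) ⟩
    ½ * (1ℚ + ι k)
      ≡⟨ cong (½ *_) (trans (cong (_+ ι k) (≡-sym ι-1)) (≡-sym (ι-+ 1 k))) ⟩
    ½ * ι (suc k) ∎
    where
    open ℚ.≤-Reasoning
    X = ι x; Y = ι y; Z = ι z
    X′ = ι (wt u); Y′ = ι (wt v); Z′ = ι (wt w)
    offset-additive : ∀ {p q r} → p ≡ X + X′ → q ≡ Y + Y′ → r ≡ Z + Z′ →
                      offset t p q r ≡ offset t X Y Z + offset t X′ Y′ Z′
    offset-additive refl refl refl = solve 7 (λ t x y z x′ y′ z′ →
      (x :+ x′) :+ t :* ((y :+ y′) :- (x :+ x′)) :- (z :+ z′)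
        := (x :+ t :* (y :- x) :- z) :+ (x′ :+ t :* (y′ :- x′) :- z′)) refl t X Y Z X′ Y′ Z′

  ¼ 5/2 : ℚ
  ¼ = + 1 / 4
  5/2 = + 5 / 2

  -- A, B, B′, W: one coordinate of u, v, v′, w;  Δ = b − a;  K = k
  drift≤12 : (A B B′ W s s′ Δ K : ℚ) →
    0≤ ½ - offset s A B W → 0≤ ½ + offset s′ A B′ W →
    0≤ s - ¼ → 0≤ K - (s′ - s) * Δ → 0≤ B′ - A → 0≤ ℕtoℚ 2 * Δ - K * (B′ - A) →
    0ℚ < Δ → 0ℚ < K →
    0≤ ℕtoℚ 12 - (B - B′)
  drift≤12 A B B′ W s s′ Δ K near near′ s≥¼ shift A≤B′ B′-A≤ 0<Δ 0<K with 0≤∨0≤- (B - B′)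
  ... | inj₂ B≤B′ = 0≤-≡ (0≤-+ (ℚ.nonNegative⁻¹ _) B≤B′)
    (solve 2 (λ B B′ → con (ℕtoℚ 12) :+ (:- (B :- B′)) := con (ℕtoℚ 12) :- (B :- B′)) refl B B′)
  ... | inj₁ B′≤B = 0≤-≡ (0≤-+ (0≤-* (ℚ.nonNegative⁻¹ _) s[B-B′]≤3) (0≤-* (ℚ.nonNegative⁻¹ _) (0≤-* s≥¼ B′≤B)))
    (solve 3 (λ s B B′ → con (ℕtoℚ 4) :* (con (ℕtoℚ 3) :- s :* (B :- B′)) :+ con (ℕtoℚ 4) :* ((s :- con ¼) :* (B :- B′))
                          := con (ℕtoℚ 12) :- (B :- B′)) refl s B B′)
    where
    0≤K = ℚ.<⇒≤ 0<K
    -- no sign condition on s′ − s is needed once everything is multiplied by Δ K > 0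
    cross≤2 : 0≤ ℕtoℚ 2 - (s′ - s) * (B′ - A)
    cross≤2 = 0≤-cancelʳ (0<-* 0<Δ 0<K) (0≤-≡ (0≤-+ (0≤-* 0≤K B′-A≤) (0≤-* (0≤-* 0≤K A≤B′) shift))
      (solve 7 (λ K Δ B′ A s s′ c2 → K :* (c2 :* Δ :- K :* (B′ :- A)) :+ (K :* (B′ :- A)) :* (K :- (s′ :- s) :* Δ)
                  := (c2 :- (s′ :- s) :* (B′ :- A)) :* (Δ :* K)) refl K Δ B′ A s s′ (ℕtoℚ 2)))
    s[B-B′]≤3 : 0≤ ℕtoℚ 3 - s * (B - B′)
    s[B-B′]≤3 = 0≤-≡ (0≤-+ (0≤-+ near near′) cross≤2)
      (solve 6 (λ A B B′ W s s′ → ((con ½ :- (A :+ s :* (B :- A) :- W)) :+ (con ½ :+ (A :+ s′ :* (B′ :- A) :- W)))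
                                   :+ (con (ℕtoℚ 2) :- (s′ :- s) :* (B′ :- A))
                                  := con (ℕtoℚ 3) :- s :* (B :- B′)) refl A B B′ W s s′)

  drift≤12-upper : (a b W K t t′ u v v′ w : ℚ) →
    0≤ ½ * K + offset t a b W → 0≤ ½ * K - offset t′ a b W →
    0≤ ½ - offset t u v w → 0≤ ½ + offset t′ u v′ w →
    0≤ ℕtoℚ 2 * W - a - b → 0≤ (b - a) - ℕtoℚ 12 * K → 0ℚ < K →
    0≤ v′ - u → 0≤ ℕtoℚ 2 * (b - a) - K * (v′ - u) →
    0≤ ℕtoℚ 12 - (v - v′)
  drift≤12-upper a b W K t t′ u v v′ w weight weight′ near near′ upper gap 0<K u≤v′ v′-u≤ =
    drift≤12 u v v′ w t t′ (b - a) K near near′ t≥¼ shift u≤v′ v′-u≤ 0<Δ 0<K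
    where
    0<Δ : 0ℚ < b - a
    0<Δ = ℚ.<-≤-trans (0<-* (ℚ.positive⁻¹ _) 0<K) (0≤-⇒≤ gap)
    t≥¼ : 0≤ t - ¼
    t≥¼ = 0≤-cancelʳ 0<Δ (0≤-≡
      (0≤-+ (0≤-+ (0≤-+ weight (0≤-* (ℚ.nonNegative⁻¹ _) upper)) (0≤-* (ℚ.nonNegative⁻¹ _) gap))
            (0≤-* (ℚ.nonNegative⁻¹ _) (ℚ.<⇒≤ 0<K)))
      (solve 5 (λ a b W K t → (((con ½ :* K :+ (a :+ t :* (b :- a) :- W)) :+ con ½ :* (con (ℕtoℚ 2) :* W :- a :- b))
                               :+ con ¼ :* ((b :- a) :- con (ℕtoℚ 12) :* K)) :+ con 5/2 :* K
                              := (t :- con ¼) :* (b :- a)) refl a b W K t))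
    shift : 0≤ K - (t′ - t) * (b - a)
    shift = 0≤-≡ (0≤-+ weight′ weight)
      (solve 6 (λ a b W K t t′ → (con ½ :* K :- (a :+ t′ :* (b :- a) :- W)) :+ (con ½ :* K :+ (a :+ t :* (b :- a) :- W))
                                 := K :- (t′ :- t) :* (b :- a)) refl a b W K t t′)

  drift≤12-lower : (a b W K t t′ u u′ v w : ℚ) →
    0≤ ½ * K - offset t a b W → 0≤ ½ * K + offset t′ a b W →
    0≤ ½ + offset t u v w → 0≤ ½ - offset t′ u′ v w →
    0≤ a + b - ℕtoℚ 2 * W → 0≤ (b - a) - ℕtoℚ 12 * K → 0ℚ < K →
    0≤ v - u′ → 0≤ ℕtoℚ 2 * (b - a) - K * (v - u′) →
    0≤ ℕtoℚ 12 - (u′ - u)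
  drift≤12-lower a b W K t t′ u u′ v w weight weight′ near near′ lower gap 0<K u′≤v v-u′≤ =
    0≤-≡ (drift≤12-upper (- b) (- a) (- W) K (1ℚ - t) (1ℚ - t′) (- v) (- u) (- u′) (- w)
            (0≤-≡ weight (−offset≡mirrored (½ * K) t a b W)) (0≤-≡ weight′ (+offset≡mirrored (½ * K) t′ a b W))
            (0≤-≡ near (+offset≡mirrored ½ t u v w)) (0≤-≡ near′ (−offset≡mirrored ½ t′ u′ v w))
            (0≤-≡ lower (solve 3 (λ a b W → a :+ b :- con (ℕtoℚ 2) :* W := con (ℕtoℚ 2) :* (:- W) :- (:- b) :- (:- a)) refl a b W))
            (0≤-≡ gap (cong (λ Δ → Δ - ℕtoℚ 12 * K) (negated-diff a b)))
            0<K
            (0≤-≡ u′≤v (negated-diff u′ v))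
            (0≤-≡ v-u′≤ (cong₂ (λ Δ δ → ℕtoℚ 2 * Δ - K * δ) (negated-diff a b) (negated-diff u′ v))))
         (cong (λ δ → ℕtoℚ 12 - δ) (≡-sym (negated-diff u u′)))
    where
    -- reflecting the segment through the origin reverses its parametrisation
    −offset≡mirrored : ∀ r t x y z → r - offset t x y z ≡ r + offset (1ℚ - t) (- y) (- x) (- z)
    −offset≡mirrored r t x y z = solve 5 (λ r t x y z →
      r :- (x :+ t :* (y :- x) :- z) := r :+ ((:- y) :+ (con 1ℚ :- t) :* ((:- x) :- (:- y)) :- (:- z))) refl r t x y z
    +offset≡mirrored : ∀ r t x y z → r + offset t x y z ≡ r - offset (1ℚ - t) (- y) (- x) (- z)
    +offset≡mirrored r t x y z = solve 5 (λ r t x y z →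
      r :+ (x :+ t :* (y :- x) :- z) := r :- ((:- y) :+ (con 1ℚ :- t) :* ((:- x) :- (:- y)) :- (:- z))) refl r t x y z
    negated-diff : ∀ x y → y - x ≡ (- x) - (- y)
    negated-diff x y = solve 2 (λ x y → y :- x := (:- x) :- (:- y)) refl x y

  ι-≤⇒0≤- : ∀ {m n} → m ℕ.≤ n → 0≤ ι n - ι m
  ι-≤⇒0≤- m≤n = ≤⇒0≤- (ι-mono-≤ m≤n)

  ι-2* : ∀ m → ι (2 ℕ.* m) ≡ ℕtoℚ 2 * ι m
  ι-2* m = trans (ι-* 2 m) (cong (_* ι m) (cong-app ι≡ℕtoℚ 2))

  ι-12*k*L : ∀ k L → ι (12 ℕ.* k ℕ.* L) ≡ ℕtoℚ 12 * ι k * ι L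
  ι-12*k*L k L = trans (ι-* (12 ℕ.* k) L) (cong (_* ι L) (trans (ι-* 12 k) (cong (_* ι k) (cong-app ι≡ℕtoℚ 12))))

  layer-coordinate-bounds : ∀ {n k L a} {x : Vertex k} → x ∈ Low n k L a → ∀ c →
    0≤ ι a + ℕtoℚ 2 * ι k * ι L - ι k * ι (lookup x c) ×
    0≤ ι k * ι (lookup x c) + ℕtoℚ 2 * ι k * ι L - ι a
  layer-coordinate-bounds {n} {k} {L} {a} {x} x∈Low c
    with refl , i , near ← ∈Low⁻ {n} {k} {L} {a} x∈Low =
    0≤-≡ (0≤-+ wt≥ (0≤-* (0≤ι k) xc≤i+L))
      (solve 5 (λ A K L I X → (A :+ K :* L :- K :* I) :+ K :* (I :+ L :- X) := A :+ con (ℕtoℚ 2) :* K :* L :- K :* X) refl A K Lq I X) ,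
    0≤-≡ (0≤-+ wt≤ (0≤-* (0≤ι k) i≤xc+L))
      (solve 5 (λ A K L I X → (K :* (I :+ L) :- A) :+ K :* (X :+ L :- I) := K :* X :+ con (ℕtoℚ 2) :* K :* L :- A) refl A K Lq I X)
    where
    X = ι (lookup x c); I = ι i; Lq = ι L; K = ι k; A = ι (wt x)
    xc≤i+L : 0≤ I + Lq - X
    xc≤i+L = 0≤-≡ (ι-≤⇒0≤- (proj₁ (∣-∣≤⇒≤+ (near c)))) (cong (_- X) (ι-+ i L))
    i≤xc+L : 0≤ X + Lq - I
    i≤xc+L = 0≤-≡ (ι-≤⇒0≤- (proj₂ (∣-∣≤⇒≤+ (near c)))) (cong (_- I) (ι-+ (lookup x c) L))
    wt≤ : 0≤ K * (I + Lq) - A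
    wt≤ = 0≤-≡ (ι-≤⇒0≤- (Within⇒wt≤ x near)) (cong (_- A) (trans (ι-* k (i ℕ.+ L)) (cong (K *_) (ι-+ i L))))
    wt≥ : 0≤ A + K * Lq - K * I
    wt≥ = 0≤-≡ (ι-≤⇒0≤- (Within⇒wt≥ x near)) (cong₂ _-_ (trans (ι-+ (wt x) (k ℕ.* L)) (cong (λ q → A + q) (ι-* k L))) (ι-* k i))

  endpoint-bounds : ∀ {n k L a b} {u v : Vertex k} → u ∈ Low n k L a → v ∈ Low n k L b →
    0ℚ < ι k → 0≤ (ι b - ι a) - ℕtoℚ 12 * ι k * ι L → ∀ c →
    0≤ ι (lookup v c) - ι (lookup u c) ×
    0≤ ℕtoℚ 2 * (ι b - ι a) - ι k * (ι (lookup v c) - ι (lookup u c))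
  endpoint-bounds {n} {k} {L} {a} {b} {u} {v} u∈Low v∈Low 0<k gap c =
    0≤-cancelʳ 0<k (0≤-≡ (0≤-+ (0≤-+ (0≤-+ v-below u-above) gap) (0≤-* (ℚ.nonNegative⁻¹ _) 0≤kL))
      (solve 6 (λ K L A B U V → (((K :* V :+ con (ℕtoℚ 2) :* K :* L :- B) :+ (A :+ con (ℕtoℚ 2) :* K :* L :- K :* U))
                                  :+ ((B :- A) :- con (ℕtoℚ 12) :* K :* L)) :+ con (ℕtoℚ 8) :* (K :* L)
                                 := (V :- U) :* K) refl K Lq A B U V)) ,
    0≤-≡ (0≤-+ (0≤-+ (0≤-+ v-above u-below) gap) (0≤-* (ℚ.nonNegative⁻¹ _) 0≤kL))
      (solve 6 (λ K L A B U V → (((B :+ con (ℕtoℚ 2) :* K :* L :- K :* V) :+ (K :* U :+ con (ℕtoℚ 2) :* K :* L :- A))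
                                  :+ ((B :- A) :- con (ℕtoℚ 12) :* K :* L)) :+ con (ℕtoℚ 8) :* (K :* L)
                                 := con (ℕtoℚ 2) :* (B :- A) :- K :* (V :- U)) refl K Lq A B U V)
    where
    K = ι k; Lq = ι L; A = ι a; B = ι b; U = ι (lookup u c); V = ι (lookup v c)
    0≤kL = 0≤-* (0≤ι k) (0≤ι L)
    u-above = proj₁ (layer-coordinate-bounds {n} {k} {L} {a} u∈Low c)
    u-below = proj₂ (layer-coordinate-bounds {n} {k} {L} {a} u∈Low c)
    v-above = proj₁ (layer-coordinate-bounds {n} {k} {L} {b} v∈Low c)
    v-below = proj₂ (layer-coordinate-bounds {n} {k} {L} {b} v∈Low c)

  CubeOffsets : ∀ {k} → ℚ → Vertex k → Vertex k → Vertex k → Set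
  CubeOffsets {k} t s u v = (c : Fin k) → ∣ offset t (ι (lookup u c)) (ι (lookup v c)) (ι (lookup s c)) ∣ ≤ ½

  CubeMeetsSeg⇒offsets : ∀ {k} {s u v : Vertex k} → CubeMeetsSeg s u v → ∃ λ t → CubeOffsets t s u v
  CubeMeetsSeg⇒offsets {s = s} {u} {v} (t , _ , _ , meets) =
    t , subst (λ f → ∀ c → ∣ offset t (f (lookup u c)) (f (lookup v c)) (f (lookup s c)) ∣ ≤ ½) (≡-sym ι≡ℕtoℚ) meets

  layer-offsets : ∀ {n k L a b} t (w : Vertex k) {u v} → u ∈ Low n k L a → v ∈ Low n k L b → CubeOffsets t w u v →
    0≤ ½ * ι k - offset t (ι a) (ι b) (ι (wt w)) × 0≤ ½ * ι k + offset t (ι a) (ι b) (ι (wt w))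
  layer-offsets {n} {k} {L} {a} {b} t w {u} {v} u∈Low v∈Low near
    with refl , _ ← ∈Low⁻ {n} {k} {L} {a} u∈Low | refl , _ ← ∈Low⁻ {n} {k} {L} {b} v∈Low =
    ∣∣≤⇒0≤± (weight-offset≤ t u v w near)

  0<ι : ∀ {k} → 1 ℕ.≤ k → 0ℚ < ι k
  0<ι {k} k≥1 = ℚ.<-≤-trans (ℚ.positive⁻¹ 1ℚ) (subst (_≤ ι k) ι-1 (ι-mono-≤ k≥1))

  gap-bounds : ∀ {k L a b} → 1 ℕ.≤ L → a ℕ.+ 12 ℕ.* k ℕ.* L ℕ.≤ b →
    0≤ (ι b - ι a) - ℕtoℚ 12 * ι k * ι L × 0≤ (ι b - ι a) - ℕtoℚ 12 * ι k
  gap-bounds {k} {L} {a} {b} L≥1 gap = gapL ,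
    0≤-≡ (0≤-+ gapL (0≤-* (ℚ.nonNegative⁻¹ _) (0≤-* (0≤ι k) (≤⇒0≤- (subst (_≤ ι L) ι-1 (ι-mono-≤ L≥1))))))
      (solve 4 (λ B A K L → ((B :- A) :- con (ℕtoℚ 12) :* K :* L) :+ con (ℕtoℚ 12) :* (K :* (L :- con 1ℚ))
                            := (B :- A) :- con (ℕtoℚ 12) :* K) refl (ι b) (ι a) (ι k) (ι L))
    where
    gapL = 0≤-≡ (ι-≤⇒0≤- gap) (trans (cong (λ q → ι b - q) (trans (ι-+ a (12 ℕ.* k ℕ.* L)) (cong (λ q → ι a + q) (ι-12*k*L k L))))
      (solve 5 (λ B A T K L → B :- (A :+ T :* K :* L) := (B :- A) :- T :* K :* L) refl (ι b) (ι a) (ℕtoℚ 12) (ι k) (ι L)))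

  0≤12-ι⇒≤ : ∀ {x y} → 0≤ ℕtoℚ 12 - (ι x - ι y) → x ℕ.≤ y ℕ.+ 12
  0≤12-ι⇒≤ {x} {y} h = ι-cancel-≤ (0≤-⇒≤ (0≤-≡ h (trans
    (solve 2 (λ X Y → con (ℕtoℚ 12) :- (X :- Y) := (Y :+ con (ℕtoℚ 12)) :- X) refl (ι x) (ι y))
    (cong (_- ι x) (≡-sym (trans (ι-+ y 12) (cong (λ q → ι y + q) (cong-app ι≡ℕtoℚ 12))))))))

  endpoints-close : ∀ {n k L a b} {w u v v′ : Vertex k} → 1 ℕ.≤ k → 1 ℕ.≤ L →
    a ℕ.+ 12 ℕ.* k ℕ.* L ℕ.≤ b → a ℕ.+ b ℕ.≤ 2 ℕ.* wt w →
    u ∈ Low n k L a → v ∈ Low n k L b → v′ ∈ Low n k L b →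
    CubeMeetsSeg w u v → CubeMeetsSeg w u v′ → ∀ c → lookup v c ℕ.≤ lookup v′ c ℕ.+ 12
  endpoints-close {n} {k} {L} {a} {b} {w} {u} {v} {v′} k≥1 L≥1 gap upper u∈Low v∈Low v′∈Low meets meets′ c
    with t , near ← CubeMeetsSeg⇒offsets {s = w} {u} {v} meets | t′ , near′ ← CubeMeetsSeg⇒offsets {s = w} {u} {v′} meets′ =
    0≤12-ι⇒≤ (drift≤12-upper (ι a) (ι b) (ι (wt w)) (ι k) t t′
                (ι (lookup u c)) (ι (lookup v c)) (ι (lookup v′ c)) (ι (lookup w c))
                (proj₂ (layer-offsets {n} {k} {L} t w u∈Low v∈Low near))
                (proj₁ (layer-offsets {n} {k} {L} t′ w u∈Low v′∈Low near′))
                (proj₁ (∣∣≤⇒0≤± (near c))) (proj₂ (∣∣≤⇒0≤± (near′ c)))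
                upper-ℚ (proj₂ (gap-bounds L≥1 gap)) (0<ι k≥1)
                (proj₁ bounds) (proj₂ bounds))
    where
    bounds = endpoint-bounds {n} {k} {L} u∈Low v′∈Low (0<ι k≥1) (proj₁ (gap-bounds L≥1 gap)) c
    upper-ℚ : 0≤ ℕtoℚ 2 * ι (wt w) - ι a - ι b
    upper-ℚ = 0≤-≡ (ι-≤⇒0≤- upper) (trans (cong₂ _-_ (ι-2* (wt w)) (ι-+ a b))
      (solve 3 (λ W A B → con (ℕtoℚ 2) :* W :- (A :+ B) := con (ℕtoℚ 2) :* W :- A :- B) refl (ι (wt w)) (ι a) (ι b)))

  startpoints-close : ∀ {n k L a b} {w u u′ v : Vertex k} → 1 ℕ.≤ k → 1 ℕ.≤ L →
    a ℕ.+ 12 ℕ.* k ℕ.* L ℕ.≤ b → 2 ℕ.* wt w ℕ.≤ a ℕ.+ b →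
    u ∈ Low n k L a → u′ ∈ Low n k L a → v ∈ Low n k L b →
    CubeMeetsSeg w u v → CubeMeetsSeg w u′ v → ∀ c → lookup u′ c ℕ.≤ lookup u c ℕ.+ 12
  startpoints-close {n} {k} {L} {a} {b} {w} {u} {u′} {v} k≥1 L≥1 gap lower u∈Low u′∈Low v∈Low meets meets′ c
    with t , near ← CubeMeetsSeg⇒offsets {s = w} {u} {v} meets | t′ , near′ ← CubeMeetsSeg⇒offsets {s = w} {u′} {v} meets′ =
    0≤12-ι⇒≤ (drift≤12-lower (ι a) (ι b) (ι (wt w)) (ι k) t t′
                (ι (lookup u c)) (ι (lookup u′ c)) (ι (lookup v c)) (ι (lookup w c))
                (proj₁ (layer-offsets {n} {k} {L} t w u∈Low v∈Low near))
                (proj₂ (layer-offsets {n} {k} {L} t′ w u′∈Low v∈Low near′))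
                (proj₂ (∣∣≤⇒0≤± (near c))) (proj₁ (∣∣≤⇒0≤± (near′ c)))
                lower-ℚ (proj₂ (gap-bounds L≥1 gap)) (0<ι k≥1)
                (proj₁ bounds) (proj₂ bounds))
    where
    bounds = endpoint-bounds {n} {k} {L} u′∈Low v∈Low (0<ι k≥1) (proj₁ (gap-bounds L≥1 gap)) c
    lower-ℚ : 0≤ ι a + ι b - ℕtoℚ 2 * ι (wt w)
    lower-ℚ = 0≤-≡ (ι-≤⇒0≤- lower) (cong₂ _-_ (ι-+ a b) (ι-2* (wt w)))

open import Defs
open import Data.Nat using (ℕ; _+_; _*_; _∸_; _^_; _≤_; _<_; _/_)
open import Data.Nat.Divisibility using (_∣_)
open import Data.List using (List; length)
open import Data.List.Membership.Propositional using (_∈_)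
open import Data.List.Relation.Unary.All using (All)
open import Data.List.Relation.Unary.Unique.Propositional using (Unique)
open import Data.Product using (_×_; _,_)

open import Data.Nat using (suc; s≤s; >-nonZero)
import Data.Nat.Properties as ℕ
open import Data.Nat.Divisibility using (divides; ∣-trans; ∣⇒≤)
open import Data.Nat.Solver using (module +-*-Solver)
open import Data.List using (map)
open import Data.List.Membership.Propositional.Properties using (∈-map⁻)
import Data.List.Properties as List
import Data.List.Relation.Unary.All as All
import Data.List.Relation.Unary.Unique.Propositional.Properties as Unique
open import Data.Vec using (lookup)
open import Data.Vec.Properties using (≡-dec)
open import Data.Product using (proj₁; proj₂; swap)
open import Data.Sum using (inj₁; inj₂)
open import Relation.Binary.PropositionalEquality using (_≡_; refl; sym; trans; cong; subst)
open Counting using (Unique-pairs-length≤)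
open Layers using (Low-length≥)
open SegmentArithmetic using (endpoints-close; startpoints-close)

common-divisor-<⇒+≤ : ∀ {ρ c N} → ρ ∣ c → ρ ∣ N → c < N → c + ρ ≤ N
common-divisor-<⇒+≤ {ρ} (divides x refl) (divides y refl) x*ρ<y*ρ =
  subst (_≤ y * ρ) (ℕ.+-comm ρ (x * ρ)) (ℕ.*-monoˡ-≤ ρ (ℕ.*-cancelʳ-< ρ x y x*ρ<y*ρ))

layer-length≥ : ∀ {n k L ρ c} → 1 ≤ n → 1 ≤ k → ρ ∣ k * (n ∸ 1) → k ∣ ρ → 12 * k * L ≤ ρ →
  ρ ∣ c → 0 < c → c < k * (n ∸ 1) → (2 * L + 1) ^ (k / 2) ≤ length (Low n k L c)
layer-length≥ {suc n} {k@(suc _)} {L} {ρ} _ _ ρ∣N k∣ρ 12kL≤ρ ρ∣c c>0 c<N with divides q refl ← ∣-trans k∣ρ ρ∣c =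
  subst (λ c → (2 * L + 1) ^ (k / 2) ≤ length (Low (suc n) k L c)) k*[q∸L+L]≡q*k
    (Low-length≥ (suc n) k L (q ∸ L) (s≤s (subst (λ m → m + L ≤ n) (sym q∸L+L≡q) q+L≤n)))
  where
  open +-*-Solver
  L≤q : L ≤ q
  L≤q = ℕ.*-cancelˡ-≤ k (ℕ.≤-trans (ℕ.*-monoˡ-≤ L (ℕ.m≤n*m k 12))
          (ℕ.≤-trans 12kL≤ρ (ℕ.≤-trans (∣⇒≤ {{>-nonZero c>0}} ρ∣c) (ℕ.≤-reflexive (ℕ.*-comm q k)))))
  k*[q+12L]≤k*n : k * (q + 12 * L) ≤ k * n
  k*[q+12L]≤k*n = ℕ.≤-trans (ℕ.≤-reflexive (solve 3 (λ k q L → k :* (q :+ con 12 :* L) := q :* k :+ con 12 :* k :* L) refl k q L))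
    (ℕ.≤-trans (ℕ.+-monoʳ-≤ (q * k) 12kL≤ρ) (common-divisor-<⇒+≤ ρ∣c ρ∣N c<N))
  q+L≤n : q + L ≤ n
  q+L≤n = ℕ.≤-trans (ℕ.+-monoʳ-≤ q (ℕ.m≤n*m L 12)) (ℕ.*-cancelˡ-≤ k k*[q+12L]≤k*n)
  q∸L+L≡q : q ∸ L + L ≡ q
  q∸L+L≡q = ℕ.m∸n+n≡m L≤q
  k*[q∸L+L]≡q*k : k * (q ∸ L + L) ≡ q * k
  k*[q∸L+L]≡q*k = trans (cong (k *_) q∸L+L≡q) (ℕ.*-comm k q)

InS⇒CubeMeetsSeg : ∀ {k} {w u v : Vertex k} → InS w u v → CubeMeetsSeg w u v
InS⇒CubeMeetsSeg (_ , ((_ , cubes) , _) , w∈s) = All.lookup cubes w∈s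

Unique-pairs-length≤17^k : ∀ {k} (P : List (Vertex k × Vertex k)) (keys : List (Vertex k)) → Unique P →
  (∀ {u v} → (u , v) ∈ P → u ∈ keys) →
  (∀ {u v v′} → (u , v) ∈ P → (u , v′) ∈ P → ∀ c → lookup v c ≤ lookup v′ c + 12) →
  length P ≤ length keys * 17 ^ k
Unique-pairs-length≤17^k {k} P keys unique keyed spread =
  ℕ.≤-trans (Unique-pairs-length≤ (≡-dec ℕ._≟_) 12 P keys unique keyed spread)
            (ℕ.*-monoʳ-≤ (length keys) (ℕ.^-monoˡ-≤ k (ℕ.m≤m+n 13 4)))

PairsThrough : ∀ {k} (n L a b : ℕ) → Vertex k → List (Vertex k × Vertex k) → Set
PairsThrough n L a b w P = All (λ { (u , v) → u ∈ Low n _ L a × v ∈ Low n _ L b × InS w u v }) P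

upper-pairs-length≤ : ∀ {n k L a b} {w : Vertex k} (P : List (Vertex k × Vertex k)) →
  1 ≤ k → 1 ≤ L → a + 12 * k * L ≤ b → a + b ≤ 2 * wt w → Unique P → PairsThrough n L a b w P →
  length P ≤ length (Low n k L a) * 17 ^ k
upper-pairs-length≤ {n} {k} {L} {a} {b} {w} P k≥1 L≥1 gap upper unique through =
  Unique-pairs-length≤17^k P (Low n k L a) unique (λ uv∈P → proj₁ (All.lookup through uv∈P)) spread
  where
  spread : ∀ {u v v′} → (u , v) ∈ P → (u , v′) ∈ P → ∀ c → lookup v c ≤ lookup v′ c + 12
  spread uv∈P uv′∈P with u∈ , v∈ , uv∋w ← All.lookup through uv∈P | _ , v′∈ , uv′∋w ← All.lookup through uv′∈P =
    endpoints-close {w = w} k≥1 L≥1 gap upper u∈ v∈ v′∈ (InS⇒CubeMeetsSeg uv∋w) (InS⇒CubeMeetsSeg uv′∋w)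

lower-pairs-length≤ : ∀ {n k L a b} {w : Vertex k} (P : List (Vertex k × Vertex k)) →
  1 ≤ k → 1 ≤ L → a + 12 * k * L ≤ b → 2 * wt w ≤ a + b → Unique P → PairsThrough n L a b w P →
  length P ≤ length (Low n k L b) * 17 ^ k
lower-pairs-length≤ {n} {k} {L} {a} {b} {w} P k≥1 L≥1 gap lower unique through =
  subst (_≤ length (Low n k L b) * 17 ^ k) (List.length-map swap P)
    (Unique-pairs-length≤17^k (map swap P) (Low n k L b) (Unique.map⁺ (cong swap) unique) keyed spread)
  where
  keyed : ∀ {v u} → (v , u) ∈ map swap P → v ∈ Low n k L b
  keyed vu∈ with _ , uv∈P , refl ← ∈-map⁻ swap vu∈ = proj₁ (proj₂ (All.lookup through uv∈P))
  spread : ∀ {v u u′} → (v , u) ∈ map swap P → (v , u′) ∈ map swap P → ∀ c → lookup u c ≤ lookup u′ c + 12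
  spread vu∈ vu′∈ with _ , uv∈P , refl ← ∈-map⁻ swap vu∈ | _ , u′v∈P , refl ← ∈-map⁻ swap vu′∈
    with u∈ , v∈ , uv∋w ← All.lookup through uv∈P | u′∈ , _ , u′v∋w ← All.lookup through u′v∈P =
    startpoints-close {w = w} k≥1 L≥1 gap lower u′∈ u∈ v∈ (InS⇒CubeMeetsSeg u′v∋w) (InS⇒CubeMeetsSeg uv∋w)

lemma10 : (n k L ρ : ℕ) → 1 ≤ n → 1 ≤ k → 1 ≤ L → 1 ≤ ρ →
    ρ ∣ k * (n ∸ 1) → k ∣ ρ → 12 * k * L ≤ ρ →
    (w : Vertex k) → w ∈ Tube n k L →
    (a b : ℕ) → ρ ∣ a → 0 < a → a < k * (n ∸ 1) →
    ρ ∣ b → 0 < b → b < k * (n ∸ 1) → a + 12 * k * L ≤ b →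
    (P : List (Vertex k × Vertex k)) → Unique P →
    All (λ { (u , v) → u ∈ Low n k L a × v ∈ Low n k L b × InS w u v }) P →
    length P * (2 * L + 1) ^ (k / 2)
      ≤ 17 ^ k * (length (Low n k L a) * length (Low n k L b))
lemma10 n k L ρ n≥1 k≥1 L≥1 _ ρ∣N k∣ρ 12kL≤ρ w _ a b ρ∣a a>0 a<N ρ∣b b>0 b<N gap P unique through
  with ℕ.≤-total (a + b) (2 * wt w)
... | inj₁ upper = begin
  length P * (2 * L + 1) ^ (k / 2)
    ≤⟨ ℕ.*-mono-≤ (upper-pairs-length≤ P k≥1 L≥1 gap upper unique through)
                  (layer-length≥ n≥1 k≥1 ρ∣N k∣ρ 12kL≤ρ ρ∣b b>0 b<N) ⟩
  length (Low n k L a) * 17 ^ k * length (Low n k L b)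
    ≡⟨ solve 3 (λ A B s → A :* s :* B := s :* (A :* B)) refl (length (Low n k L a)) (length (Low n k L b)) (17 ^ k) ⟩
  17 ^ k * (length (Low n k L a) * length (Low n k L b)) ∎
  where open ℕ.≤-Reasoning; open +-*-Solver
... | inj₂ lower = begin
  length P * (2 * L + 1) ^ (k / 2)
    ≤⟨ ℕ.*-mono-≤ (lower-pairs-length≤ P k≥1 L≥1 gap lower unique through)
                  (layer-length≥ n≥1 k≥1 ρ∣N k∣ρ 12kL≤ρ ρ∣a a>0 a<N) ⟩
  length (Low n k L b) * 17 ^ k * length (Low n k L a)
    ≡⟨ solve 3 (λ A B s → B :* s :* A := s :* (A :* B)) refl (length (Low n k L a)) (length (Low n k L b)) (17 ^ k) ⟩
  17 ^ k * (length (Low n k L a) * length (Low n k L b)) ∎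
  where open ℕ.≤-Reasoning; open +-*-Solver
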